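{- Let $M$ be a simple matroid on $E$, let $X$ be a modular coatom of $M$, and suppose $M|X$ is a modular join $M|X=P_Y(F_1,F_2)$. Then $M$ is a modular join $P_Y(F_1',F_2)$ or $P_Y(F_1,F_2')$, where $F_i'$ is some flat of $M$ such that $F_i$ is a modular coatom of $M|F_i'$.
   Context: All matroids are finite. For a simple matroid $M$ on ground set $E$ with rank function $r$, flats ordered by inclusion form the lattice $L(M)$, with $X\vee Y=\mathrm{cl}(X\cup Y)$. A coatom is a flat of rank $r(E)-1$. A flat $X$ is modular if $r(X)+r(Y)=r(X\cap Y)+r(X\vee Y)$ for all flats $Y$. For a simple matroid $N$ on ground set $S$, $N=P_Y(F_1,F_2)$ means $F_1,F_2$ are proper modular flats of $N$ with $F_1\cup F_2=S$ and $F_1\cap F_2=Y$ (a modular join over $Y$). -}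

module Defs where

open import Data.Nat using (ℕ; suc; _≤_; _+_; _≡ᵇ_)
open import Data.Bool using (_∧_)
open import Data.Fin using (Fin)
open import Data.Fin.Subset using (Subset; _∈_; _∉_; _⊆_; _⊂_; _∪_; _∩_; ⁅_⁆; ⊤; ∣_∣)
open import Data.Vec using (tabulate; lookup)
open import Data.Product using (_×_)
open import Relation.Binary.PropositionalEquality using (_≡_; _≢_)

record Matroid (n : ℕ) : Set where
  field
    rk          : Subset n → ℕ
    rk-bounded  : ∀ A → rk A ≤ ∣ A ∣
    rk-mono     : ∀ A B → A ⊆ B → rk A ≤ rk B
    rk-submod   : ∀ A B → rk (A ∪ B) + rk (A ∩ B) ≤ rk A + rk B
open Matroid public

module _ {n : ℕ} (M : Matroid n) where

  Simple : Set
  Simple = (∀ e → rk M ⁅ e ⁆ ≡ 1)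
         × (∀ e f → e ≢ f → rk M (⁅ e ⁆ ∪ ⁅ f ⁆) ≡ 2)

  -- Notions for the restriction M|G (G ⊆ E = ⊤); the rank function of M|G
  -- is rk M on subsets of G.  For G = ⊤ these are the notions for M itself.

  FlatIn : Subset n → Subset n → Set
  FlatIn G Z = Z ⊆ G × (∀ e → e ∈ G → e ∉ Z → rk M (Z ∪ ⁅ e ⁆) ≡ suc (rk M Z))

  clIn : Subset n → Subset n → Subset n
  clIn G A = tabulate (λ e → lookup G e ∧ (rk M (A ∪ ⁅ e ⁆) ≡ᵇ rk M A))

  ModularIn : Subset n → Subset n → Set
  ModularIn G Z = FlatIn G Z
    × (∀ W → FlatIn G W → rk M Z + rk M W ≡ rk M (Z ∩ W) + rk M (clIn G (Z ∪ W)))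

  CoatomIn : Subset n → Subset n → Set
  CoatomIn G Z = FlatIn G Z × suc (rk M Z) ≡ rk M G

  ModJoinIn : Subset n → Subset n → Subset n → Subset n → Set
  ModJoinIn G Y F₁ F₂ =
    ModularIn G F₁ × F₁ ⊂ G × ModularIn G F₂ × F₂ ⊂ G
    × F₁ ∪ F₂ ≡ G × F₁ ∩ F₂ ≡ Y

-- For F ⊆ X call two points e, f aligned over F when F ∪ {e, f} has rank at
-- most r(F) + 1.  Since X is a modular coatom, every line cl{e, f} meets X in
-- a point p ∈ F₁ ∪ F₂, so any two points are aligned over F₁ or over F₂; and
-- alignment over F is transitive through points outside X.  Fixing e₀ ∉ X, it
-- follows that for one of the parts, say F₁, every point outside X is aligned
-- with e₀, i.e. F₁′ = F₁ ∪ (E − X) has rank r(F₁) + 1.  Comparing ranks of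
-- flats W according to whether W ⊆ X, using r(W) ≤ r(X ∩ W) + 1 and the
-- modularity of F₁ in M|X, shows that F₁′ is a modular flat of M in which F₁
-- is a modular coatom, and that F₂ is modular in M.

module Submission where

open import Defs
open import Data.Bool using (true; _∧_; T)
open import Data.Empty using (⊥-elim)
open import Data.Fin using (Fin) renaming (_≟_ to _≟ᶠ_)
open import Data.Fin.Properties using (any?; all?; ¬∀⟶∃¬)
open import Data.Fin.Subset
  using (Subset; ⊤; ⊥; _∈_; _∉_; _⊆_; _⊂_; _∪_; _∩_; _-_; ∁; ⁅_⁆; Nonempty)
open import Data.Fin.Subset.Induction using (⊂-wellFounded)
open import Data.Fin.Subset.Properties
  using ( _∈?_; nonempty?; ∈⊤; ∉⊥; ∣⊥∣≡0; ∣⁅x⁆∣≡1; x∈⁅x⁆; x∈⁅y⁆⇒x≡y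
        ; ⊆-refl; ⊆-reflexive; ⊆-antisym; p⊆p∪q; q⊆p∪q; p∩q⊆p; p∩q⊆q
        ; x∈p∪q⁻; x∈p∩q⁺; x∈p∩q⁻; x∈∁p⇒x∉p; x∉p⇒x∈∁p; x∉∁p⇒x∈p
        ; x∈p⇒p-x⊂p; p─q⊆p; x∈p∧x≢y⇒x∈p-y
        ; p∪∁p≡⊤; ∪-comm; ∪-assoc; ∩-comm; ∪-idem; ∪-identityʳ; ∩-distribʳ-∪ )
open import Data.Nat using (ℕ; suc; _+_; _≤_; _≤?_; _≡ᵇ_; s≤s)
open import Data.Nat.Properties
open import Data.Product using (_×_; _,_; proj₁; proj₂; ∃; ∃-syntax)
open import Data.Sum using (_⊎_; inj₁; inj₂; [_,_]′)
import Data.Sum as Sum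
open import Data.Unit using (tt)
open import Data.Vec using (lookup)
open import Data.Vec.Properties using (lookup∘tabulate; []=⇒lookup; lookup⇒[]=)
open import Function using (_∘_; id)
open import Induction.WellFounded using (WfRec; module All)
open import Relation.Nullary using (¬_; Dec; yes; no; contradiction)
open import Relation.Nullary.Decidable using (¬?; _→-dec_; _×-dec_; decidable-stable)
open import Relation.Binary.PropositionalEquality
  using (_≡_; refl; sym; trans; cong; cong₂; subst; module ≡-Reasoning)

+-suc-comm : ∀ a b → a + suc b ≡ b + suc a
+-suc-comm a b = trans (+-comm a (suc b)) (sym (+-suc b a))

module _ {n : ℕ} where

  ∪-lub : {p q s : Subset n} → p ⊆ s → q ⊆ s → p ∪ q ⊆ s
  ∪-lub {p} {q} p⊆s q⊆s x∈ = [ p⊆s , q⊆s ]′ (x∈p∪q⁻ p q x∈)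

  ∩-glb : {p q s : Subset n} → s ⊆ p → s ⊆ q → s ⊆ p ∩ q
  ∩-glb s⊆p s⊆q x∈ = x∈p∩q⁺ (s⊆p x∈ , s⊆q x∈)

  ∪-mono : {p p′ q q′ : Subset n} → p ⊆ p′ → q ⊆ q′ → p ∪ q ⊆ p′ ∪ q′
  ∪-mono p⊆ q⊆ = ∪-lub (p⊆p∪q _ ∘ p⊆) (q⊆p∪q _ _ ∘ q⊆)

  ∩-mono : {p p′ q q′ : Subset n} → p ⊆ p′ → q ⊆ q′ → p ∩ q ⊆ p′ ∩ q′
  ∩-mono p⊆ q⊆ = ∩-glb (p⊆ ∘ p∩q⊆p _ _) (q⊆ ∘ p∩q⊆q _ _)

  ⁅x⁆⊆p : {x : Fin n} {p : Subset n} → x ∈ p → ⁅ x ⁆ ⊆ p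
  ⁅x⁆⊆p {x} {p} x∈p y∈ = subst (_∈ p) (sym (x∈⁅y⁆⇒x≡y x y∈)) x∈p

  x∈p∪⁅x⁆ : {x : Fin n} {p : Subset n} → x ∈ p ∪ ⁅ x ⁆
  x∈p∪⁅x⁆ {x} {p} = q⊆p∪q p ⁅ x ⁆ (x∈⁅x⁆ x)

  p⊆p-x∪⁅x⁆ : {p : Subset n} (x : Fin n) → p ⊆ (p - x) ∪ ⁅ x ⁆
  p⊆p-x∪⁅x⁆ x {y} y∈p with y ≟ᶠ x
  ... | yes refl = x∈p∪⁅x⁆
  ... | no y≢x   = p⊆p∪q _ (x∈p∧x≢y⇒x∈p-y y∈p y≢x)

  x∈p∪∁q∧x∈q⇒x∈p : {x : Fin n} {p q : Subset n} → x ∈ p ∪ ∁ q → x ∈ q → x ∈ p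
  x∈p∪∁q∧x∈q⇒x∈p {p = p} {q} x∈ x∈q =
    [ id , (λ x∈∁q → ⊥-elim (x∈∁p⇒x∉p x∈∁q x∈q)) ]′ (x∈p∪q⁻ p (∁ q) x∈)

  p⊆q⇒∁q∩p≡⊥ : {p q : Subset n} → p ⊆ q → ∁ q ∩ p ≡ ⊥
  p⊆q⇒∁q∩p≡⊥ {p} {q} p⊆q = ⊆-antisym
    (λ x∈ → let (x∈∁q , x∈p) = x∈p∩q⁻ (∁ q) p x∈ in ⊥-elim (x∈∁p⇒x∉p x∈∁q (p⊆q x∈p)))
    (⊥-elim ∘ ∉⊥)

  ⊆⊎⊈ : (p q : Subset n) → p ⊆ q ⊎ ∃ λ x → x ∈ p × x ∉ q
  ⊆⊎⊈ p q with any? (λ x → x ∈? p ×-dec ¬? (x ∈? q))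
  ... | yes witness = inj₂ witness
  ... | no none     = inj₁ λ {x} x∈p → decidable-stable (x ∈? q) (λ x∉q → none (x , x∈p , x∉q))

module _ {n : ℕ} (M : Matroid n) where

  private
    r : Subset n → ℕ
    r = rk M

    mono : {A B : Subset n} → A ⊆ B → r A ≤ r B
    mono {A} {B} = rk-mono M A B

  rk-∪-⁅⁆-≤ : ∀ A e → r (A ∪ ⁅ e ⁆) ≤ suc (r A)
  rk-∪-⁅⁆-≤ A e = begin
    r (A ∪ ⁅ e ⁆)                  ≤⟨ m≤m+n _ _ ⟩
    r (A ∪ ⁅ e ⁆) + r (A ∩ ⁅ e ⁆)  ≤⟨ rk-submod M A ⁅ e ⁆ ⟩
    r A + r ⁅ e ⁆                  ≤⟨ +-monoʳ-≤ (r A) (subst (r ⁅ e ⁆ ≤_) (∣⁅x⁆∣≡1 e) (rk-bounded M ⁅ e ⁆)) ⟩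
    r A + 1                        ≡⟨ +-comm (r A) 1 ⟩
    suc (r A)                      ∎
    where open ≤-Reasoning

  rk-∪-≤ : ∀ {A B c d} → c ≤ r (A ∩ B) → r A + r B ≤ c + d → r (A ∪ B) ≤ d
  rk-∪-≤ {A} {B} {c} {d} c≤ sum≤ = +-cancelˡ-≤ c _ _ (begin
    c + r (A ∪ B)          ≤⟨ +-monoˡ-≤ _ c≤ ⟩
    r (A ∩ B) + r (A ∪ B)  ≡⟨ +-comm (r (A ∩ B)) _ ⟩
    r (A ∪ B) + r (A ∩ B)  ≤⟨ rk-submod M A B ⟩
    r A + r B              ≤⟨ sum≤ ⟩
    c + d                  ∎)
    where open ≤-Reasoning

  rk-<-outside : ∀ {G F A B e} → FlatIn M G F → A ⊆ F → e ∈ G → e ∉ F → A ⊆ B → e ∈ B →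
                 suc (r A) ≤ r B
  rk-<-outside {F = F} {A} {B} {e} (_ , covers) A⊆F e∈G e∉F A⊆B e∈B = +-cancelˡ-≤ (r F) _ _ (begin
    r F + suc (r A)        ≡⟨ +-suc (r F) (r A) ⟩
    suc (r F) + r A        ≡⟨ cong (_+ r A) (sym (covers e e∈G e∉F)) ⟩
    r (F ∪ ⁅ e ⁆) + r A    ≤⟨ +-mono-≤ (mono (∪-lub (q⊆p∪q B F) (p⊆p∪q F ∘ ⁅x⁆⊆p e∈B)))
                                       (mono (∩-glb A⊆B A⊆F)) ⟩
    r (B ∪ F) + r (B ∩ F)  ≤⟨ rk-submod M B F ⟩
    r B + r F              ≡⟨ +-comm (r B) (r F) ⟩
    r F + r B              ∎)
    where open ≤-Reasoning

  flatIn⁺ : ∀ {G Z} → Z ⊆ G → (∀ e → e ∈ G → e ∉ Z → suc (r Z) ≤ r (Z ∪ ⁅ e ⁆)) → FlatIn M G Z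
  flatIn⁺ {Z = Z} Z⊆G grows = Z⊆G , λ e e∈G e∉Z → ≤-antisym (rk-∪-⁅⁆-≤ Z e) (grows e e∈G e∉Z)

  ∩-flatIn : ∀ {G W} → FlatIn M ⊤ W → FlatIn M G (G ∩ W)
  ∩-flatIn {G} {W} fW = flatIn⁺ (p∩q⊆p G W) λ e e∈G e∉G∩W →
    rk-<-outside fW (p∩q⊆q G W) ∈⊤ (λ e∈W → e∉G∩W (x∈p∩q⁺ (e∈G , e∈W))) (p⊆p∪q _) x∈p∪⁅x⁆

  flatIn-trans : ∀ {G W} → FlatIn M ⊤ G → FlatIn M G W → FlatIn M ⊤ W
  flatIn-trans {G} {W} fG (W⊆G , covers) = flatIn⁺ (λ _ → ∈⊤) grows
    where
    grows : ∀ e → e ∈ ⊤ → e ∉ W → suc (r W) ≤ r (W ∪ ⁅ e ⁆)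
    grows e _ e∉W with e ∈? G
    ... | yes e∈G = ≤-reflexive (sym (covers e e∈G e∉W))
    ... | no e∉G  = rk-<-outside fG W⊆G ∈⊤ e∉G (p⊆p∪q _) x∈p∪⁅x⁆

  rk-∪-≤-pointwise : ∀ B P → (∀ {e} → e ∈ P → r (B ∪ ⁅ e ⁆) ≤ r B) → r (B ∪ P) ≤ r B
  rk-∪-≤-pointwise B = All.wfRec ⊂-wellFounded _ Absorbed step
    where
    Absorbed : Subset n → Set
    Absorbed P = (∀ {e} → e ∈ P → r (B ∪ ⁅ e ⁆) ≤ r B) → r (B ∪ P) ≤ r B
    step : ∀ P → WfRec _⊂_ Absorbed P → Absorbed P
    step P rec pointwise with nonempty? P
    ... | no empty        = mono (∪-lub ⊆-refl (λ x∈P → ⊥-elim (empty (_ , x∈P))))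
    ... | yes (e , e∈P) = ≤-trans (mono split)
          (rk-∪-≤ (mono (∩-glb (p⊆p∪q _) (p⊆p∪q _))) (+-mono-≤ rest (pointwise e∈P)))
      where
      rest : r (B ∪ (P - e)) ≤ r B
      rest = rec (x∈p⇒p-x⊂p e∈P) (pointwise ∘ p─q⊆p P ⁅ e ⁆)
      split : B ∪ P ⊆ (B ∪ (P - e)) ∪ (B ∪ ⁅ e ⁆)
      split = ∪-lub (p⊆p∪q _ ∘ p⊆p∪q _) (∪-mono (q⊆p∪q B _) (q⊆p∪q B _) ∘ p⊆p-x∪⁅x⁆ e)

  ∈-clIn⁻ : ∀ {G A x} → x ∈ clIn M G A → x ∈ G × r (A ∪ ⁅ x ⁆) ≡ r A
  ∈-clIn⁻ {G} {A} {x} x∈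
    with lookup G x in x∈G | r (A ∪ ⁅ x ⁆) ≡ᵇ r A in same
       | trans (sym (lookup∘tabulate _ x)) ([]=⇒lookup x∈)
  ... | true | true | _ = lookup⇒[]= x G x∈G , ≡ᵇ⇒≡ _ _ (subst T (sym same) tt)

  ∈-clIn⁺ : ∀ {G A x} → x ∈ G → r (A ∪ ⁅ x ⁆) ≡ r A → x ∈ clIn M G A
  ∈-clIn⁺ {G} {A} {x} x∈G same = lookup⇒[]= x (clIn M G A)
    (trans (lookup∘tabulate _ x) (cong₂ _∧_ ([]=⇒lookup x∈G) (T⇒≡true (≡⇒≡ᵇ _ _ same))))
    where
    T⇒≡true : ∀ {b} → T b → b ≡ true
    T⇒≡true {true} _ = refl

  ⊆-clIn : ∀ {G A} → A ⊆ G → A ⊆ clIn M G A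
  ⊆-clIn A⊆G x∈A = ∈-clIn⁺ (A⊆G x∈A) (≤-antisym (mono (∪-lub ⊆-refl (⁅x⁆⊆p x∈A))) (mono (p⊆p∪q _)))

  rk-clIn : ∀ {G A} → A ⊆ G → r (clIn M G A) ≡ r A
  rk-clIn {G} {A} A⊆G = ≤-antisym
    (≤-trans (mono (q⊆p∪q A _)) (rk-∪-≤-pointwise A _ (≤-reflexive ∘ proj₂ ∘ ∈-clIn⁻ {G})))
    (mono (⊆-clIn A⊆G))

  clIn-flat : ∀ A → FlatIn M ⊤ (clIn M ⊤ A)
  clIn-flat A = flatIn⁺ (λ _ → ∈⊤) λ e _ e∉cl → begin
    suc (r (clIn M ⊤ A))    ≡⟨ cong suc (rk-clIn (λ _ → ∈⊤)) ⟩
    suc (r A)               ≤⟨ ≤∧≢⇒< (mono (p⊆p∪q _)) (e∉cl ∘ ∈-clIn⁺ ∈⊤ ∘ sym) ⟩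
    r (A ∪ ⁅ e ⁆)           ≤⟨ mono (∪-mono (⊆-clIn (λ _ → ∈⊤)) ⊆-refl) ⟩
    r (clIn M ⊤ A ∪ ⁅ e ⁆)  ∎
    where open ≤-Reasoning

  modularIn⁺ : ∀ {G Z} → FlatIn M G Z →
               (∀ W → FlatIn M G W → r Z + r W ≤ r (Z ∩ W) + r (Z ∪ W)) → ModularIn M G Z
  modularIn⁺ {Z = Z} fZ ineq = fZ , λ W fW → trans
    (≤-antisym (ineq W fW) (≤-trans (≤-reflexive (+-comm (r (Z ∩ W)) _)) (rk-submod M Z W)))
    (cong (r (Z ∩ W) +_) (sym (rk-clIn (∪-lub (proj₁ fZ) (proj₁ fW)))))

  modularIn⁻ : ∀ {G Z} → ModularIn M G Z →
               ∀ W → FlatIn M G W → r Z + r W ≤ r (Z ∩ W) + r (Z ∪ W)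
  modularIn⁻ {Z = Z} (fZ , eq) W fW = ≤-reflexive
    (trans (eq W fW) (cong (r (Z ∩ W) +_) (rk-clIn (∪-lub (proj₁ fZ) (proj₁ fW)))))

  modJoinIn-swap : ∀ {G Y F₁ F₂} → ModJoinIn M G Y F₁ F₂ → ModJoinIn M G Y F₂ F₁
  modJoinIn-swap {F₁ = F₁} {F₂} (m₁ , F₁⊂G , m₂ , F₂⊂G , ∪≡G , ∩≡Y) =
    m₂ , F₂⊂G , m₁ , F₁⊂G , trans (∪-comm F₂ F₁) ∪≡G , trans (∩-comm F₂ F₁) ∩≡Y

  rk-nonempty : ∀ {P} → 1 ≤ r P → Nonempty P
  rk-nonempty {P} 1≤rP with nonempty? P
  ... | yes nonempty = nonempty
  ... | no empty     = contradiction (≤-trans 1≤rP (≤-trans (mono P⊆⊥) r⊥≤0)) λ ()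
    where
    P⊆⊥ : P ⊆ ⊥
    P⊆⊥ x∈P = ⊥-elim (empty (_ , x∈P))
    r⊥≤0 : r ⊥ ≤ 0
    r⊥≤0 = subst (r ⊥ ≤_) (∣⊥∣≡0 n) (rk-bounded M ⊥)

  rk-∪-≤-through-point : ∀ {F L p} → p ∈ F → r (L ∪ ⁅ p ⁆) ≤ suc (r ⁅ p ⁆) → r (F ∪ L) ≤ suc (r F)
  rk-∪-≤-through-point {F} {L} {p} p∈F rL = ≤-trans (mono (∪-mono ⊆-refl (p⊆p∪q _)))
    (rk-∪-≤ (mono (∩-glb (⁅x⁆⊆p p∈F) (q⊆p∪q _ _)))
            (≤-trans (+-monoʳ-≤ (r F) rL) (≤-reflexive (+-suc-comm (r F) (r ⁅ p ⁆)))))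

  Aligned : Subset n → Fin n → Fin n → Set
  Aligned F e f = r (F ∪ (⁅ e ⁆ ∪ ⁅ f ⁆)) ≤ suc (r F)

  aligned? : ∀ F e f → Dec (Aligned F e f)
  aligned? F e f = r (F ∪ (⁅ e ⁆ ∪ ⁅ f ⁆)) ≤? suc (r F)

  aligned-refl : ∀ F e → Aligned F e e
  aligned-refl F e = subst (λ s → r (F ∪ s) ≤ suc (r F)) (sym (∪-idem ⁅ e ⁆)) (rk-∪-⁅⁆-≤ F e)

  aligned-sym : ∀ {F e f} → Aligned F e f → Aligned F f e
  aligned-sym {F} {e} {f} = subst (λ s → r (F ∪ s) ≤ suc (r F)) (∪-comm ⁅ e ⁆ ⁅ f ⁆)

  aligned-trans : ∀ {F x y z} → suc (r F) ≤ r (F ∪ ⁅ y ⁆) →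
                  Aligned F x y → Aligned F y z → Aligned F x z
  aligned-trans {F} {x} {y} {z} grows xy yz =
    ≤-trans (mono ⊆∪) (rk-∪-≤ (≤-trans grows (mono ⊆∩)) (+-mono-≤ xy yz))
    where
    ⊆∩ : F ∪ ⁅ y ⁆ ⊆ (F ∪ (⁅ x ⁆ ∪ ⁅ y ⁆)) ∩ (F ∪ (⁅ y ⁆ ∪ ⁅ z ⁆))
    ⊆∩ = ∩-glb (∪-mono ⊆-refl (q⊆p∪q _ _)) (∪-mono ⊆-refl (p⊆p∪q _))
    ⊆∪ : F ∪ (⁅ x ⁆ ∪ ⁅ z ⁆) ⊆ (F ∪ (⁅ x ⁆ ∪ ⁅ y ⁆)) ∪ (F ∪ (⁅ y ⁆ ∪ ⁅ z ⁆))
    ⊆∪ = ∪-lub (p⊆p∪q _ ∘ p⊆p∪q _)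
               (∪-mono (q⊆p∪q F _ ∘ p⊆p∪q _) (q⊆p∪q F _ ∘ q⊆p∪q _ _))

  module ModularCoatom {X : Subset n} (modX : ModularIn M ⊤ X) (coX : CoatomIn M ⊤ X) where

    rk-<-off-X : ∀ {A B e} → A ⊆ X → e ∉ X → A ⊆ B → e ∈ B → suc (r A) ≤ r B
    rk-<-off-X A⊆X = rk-<-outside (proj₁ modX) A⊆X ∈⊤

    outside : ∃ λ e → e ∉ X
    outside = ¬∀⟶∃¬ n (_∈ X) (_∈? X) λ all∈X →
      1+n≰n (≤-trans (≤-reflexive (proj₂ coX)) (mono (λ {x} _ → all∈X x)))

    private
      e₀ : Fin n
      e₀ = proj₁ outside

      e₀∉X : e₀ ∉ X
      e₀∉X = proj₂ outside

      e₀∈⁺ : ∀ {F} → e₀ ∈ F ∪ ∁ X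
      e₀∈⁺ {F} = q⊆p∪q F (∁ X) (x∉p⇒x∈∁p e₀∉X)

    rk≤suc-rk-X∩ : ∀ {W} → FlatIn M ⊤ W → r W ≤ suc (r (X ∩ W))
    rk≤suc-rk-X∩ {W} fW = +-cancelˡ-≤ (r X) _ _ (begin
      r X + r W              ≤⟨ modularIn⁻ modX W fW ⟩
      r (X ∩ W) + r (X ∪ W)  ≤⟨ +-monoʳ-≤ _ (mono (λ _ → ∈⊤)) ⟩
      r (X ∩ W) + r ⊤        ≡⟨ cong (r (X ∩ W) +_) (sym (proj₂ coX)) ⟩
      r (X ∩ W) + suc (r X)  ≡⟨ +-suc-comm _ _ ⟩
      r X + suc (r (X ∩ W))  ∎)
      where open ≤-Reasoning

    modularIn-X∩ : ∀ {Z W} → ModularIn M X Z → FlatIn M ⊤ W →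
                   r Z + r (X ∩ W) ≤ r (Z ∩ W) + r (Z ∪ (X ∩ W))
    modularIn-X∩ {Z} {W} mZ fW = ≤-trans (modularIn⁻ mZ (X ∩ W) (∩-flatIn fW))
      (+-monoˡ-≤ _ (mono (∩-mono ⊆-refl (p∩q⊆q X W))))

    modularIn-trans : ∀ {Z} → ModularIn M X Z → ModularIn M ⊤ Z
    modularIn-trans {Z} mZ = modularIn⁺ (flatIn-trans (proj₁ modX) (proj₁ mZ)) λ W fW → ineq fW (⊆⊎⊈ W X)
      where
      ineq : ∀ {W} → FlatIn M ⊤ W → W ⊆ X ⊎ (∃ λ e → e ∈ W × e ∉ X) →
             r Z + r W ≤ r (Z ∩ W) + r (Z ∪ W)
      ineq {W} fW (inj₁ W⊆X) = begin
        r Z + r W                          ≤⟨ +-monoʳ-≤ (r Z) (mono (∩-glb W⊆X ⊆-refl)) ⟩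
        r Z + r (X ∩ W)                    ≤⟨ modularIn-X∩ mZ fW ⟩
        r (Z ∩ W) + r (Z ∪ (X ∩ W))        ≤⟨ +-monoʳ-≤ _ (mono (∪-mono ⊆-refl (p∩q⊆q X W))) ⟩
        r (Z ∩ W) + r (Z ∪ W)              ∎
        where open ≤-Reasoning
      ineq {W} fW (inj₂ (e , e∈W , e∉X)) = begin
        r Z + r W                          ≤⟨ +-monoʳ-≤ (r Z) (rk≤suc-rk-X∩ fW) ⟩
        r Z + suc (r (X ∩ W))              ≡⟨ +-suc (r Z) _ ⟩
        suc (r Z + r (X ∩ W))              ≤⟨ s≤s (modularIn-X∩ mZ fW) ⟩
        suc (r (Z ∩ W) + r (Z ∪ (X ∩ W)))  ≡⟨ sym (+-suc _ _) ⟩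
        r (Z ∩ W) + suc (r (Z ∪ (X ∩ W)))  ≤⟨ +-monoʳ-≤ _ (rk-<-off-X (∪-lub Z⊆X (p∩q⊆p X W)) e∉X
                                                 (∪-mono ⊆-refl (p∩q⊆q X W)) (q⊆p∪q Z W e∈W)) ⟩
        r (Z ∩ W) + r (Z ∪ W)              ∎
        where
        open ≤-Reasoning
        Z⊆X : Z ⊆ X
        Z⊆X = proj₁ (proj₁ mZ)

    aligned-over-cover : Simple M → ∀ {F₁ F₂} → X ⊆ F₁ ∪ F₂ → ∀ e f →
                         Aligned F₁ e f ⊎ Aligned F₂ e f
    aligned-over-cover S {F₁} {F₂} X⊆ e f with e ≟ᶠ f
    ... | yes refl = inj₁ (aligned-refl F₁ e)
    ... | no e≢f   = Sum.map aligned-via-p aligned-via-p (x∈p∪q⁻ F₁ F₂ (X⊆ p∈X))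
      where
      line : Subset n
      line = clIn M ⊤ (⁅ e ⁆ ∪ ⁅ f ⁆)
      rk-line : r line ≡ 2
      rk-line = trans (rk-clIn (λ _ → ∈⊤)) (proj₂ S e f e≢f)
      meets : Nonempty (X ∩ line)
      meets = rk-nonempty (≤-pred (subst (_≤ suc (r (X ∩ line))) rk-line
                                         (rk≤suc-rk-X∩ (clIn-flat (⁅ e ⁆ ∪ ⁅ f ⁆)))))
      p : Fin n
      p = proj₁ meets
      p∈X : p ∈ X
      p∈X = proj₁ (x∈p∩q⁻ X line (proj₂ meets))
      rk-ef+p : r ((⁅ e ⁆ ∪ ⁅ f ⁆) ∪ ⁅ p ⁆) ≡ suc (r ⁅ p ⁆)
      rk-ef+p = trans (proj₂ (∈-clIn⁻ {⊤} (proj₂ (x∈p∩q⁻ X line (proj₂ meets)))))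
                      (trans (proj₂ S e f e≢f) (cong suc (sym (proj₁ S p))))
      aligned-via-p : ∀ {F} → p ∈ F → Aligned F e f
      aligned-via-p p∈F = rk-∪-≤-through-point p∈F (≤-reflexive rk-ef+p)

    _⁺ : Subset n → Subset n
    F ⁺ = F ∪ ∁ X

    Liftable : Subset n → Set
    Liftable F = r (F ⁺) ≤ suc (r F)

    liftable-of-aligned : ∀ {F e} → F ⊆ X → e ∉ X → (∀ g → g ∉ X → Aligned F e g) → Liftable F
    liftable-of-aligned {F} {e} F⊆X e∉X aligned = begin
      r (F ⁺)                ≤⟨ mono (∪-mono (p⊆p∪q _) ⊆-refl) ⟩
      r ((F ∪ ⁅ e ⁆) ∪ ∁ X)  ≤⟨ rk-∪-≤-pointwise _ _ absorbed ⟩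
      r (F ∪ ⁅ e ⁆)          ≤⟨ rk-∪-⁅⁆-≤ F e ⟩
      suc (r F)              ∎
      where
      open ≤-Reasoning
      absorbed : ∀ {g} → g ∈ ∁ X → r ((F ∪ ⁅ e ⁆) ∪ ⁅ g ⁆) ≤ r (F ∪ ⁅ e ⁆)
      absorbed {g} g∈∁X = begin
        r ((F ∪ ⁅ e ⁆) ∪ ⁅ g ⁆)  ≡⟨ cong r (∪-assoc F ⁅ e ⁆ ⁅ g ⁆) ⟩
        r (F ∪ (⁅ e ⁆ ∪ ⁅ g ⁆))  ≤⟨ aligned g (x∈∁p⇒x∉p g∈∁X) ⟩
        suc (r F)                ≤⟨ rk-<-off-X F⊆X e∉X (p⊆p∪q _) x∈p∪⁅x⁆ ⟩
        r (F ∪ ⁅ e ⁆)            ∎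

    aligned-other-part : Simple M → ∀ {F₁ F₂} → F₁ ⊆ X → F₂ ⊆ X → X ⊆ F₁ ∪ F₂ →
                         ∀ {e f} → f ∉ X → ¬ Aligned F₁ e f → ∀ g → g ∉ X → Aligned F₂ e g
    aligned-other-part S {F₁} {F₂} F₁⊆X F₂⊆X X⊆ {e} {f} f∉X ¬ef g g∉X
      with aligned-over-cover S X⊆ e g | aligned-over-cover S X⊆ g f
    ... | inj₂ eg | _        = eg
    ... | inj₁ eg | inj₁ gf  = ⊥-elim (¬ef (aligned-trans (rk-<-off-X F₁⊆X g∉X (p⊆p∪q _) x∈p∪⁅x⁆) eg gf))
    ... | inj₁ _  | inj₂ gf  = aligned-trans (rk-<-off-X F₂⊆X f∉X (p⊆p∪q _) x∈p∪⁅x⁆) ef (aligned-sym gf)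
      where
      ef : Aligned F₂ e f
      ef = [ ⊥-elim ∘ ¬ef , id ]′ (aligned-over-cover S X⊆ e f)

    liftable-part : Simple M → ∀ {F₁ F₂} → F₁ ⊆ X → F₂ ⊆ X → X ⊆ F₁ ∪ F₂ →
                    Liftable F₁ ⊎ Liftable F₂
    liftable-part S {F₁} F₁⊆X F₂⊆X X⊆ with all? (λ g → ¬? (g ∈? X) →-dec aligned? F₁ e₀ g)
    ... | yes all₁ = inj₁ (liftable-of-aligned F₁⊆X e₀∉X all₁)
    ... | no ¬all₁ with ¬∀⟶∃¬ n _ (λ g → ¬? (g ∈? X) →-dec aligned? F₁ e₀ g) ¬all₁
    ... | f₀ , ¬[f₀∉X⇒aligned] = inj₂ (liftable-of-aligned F₂⊆X e₀∉X
          (aligned-other-part S F₁⊆X F₂⊆X X⊆ f₀∉X (λ aligned → ¬[f₀∉X⇒aligned] λ _ → aligned)))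
      where
      f₀∉X : f₀ ∉ X
      f₀∉X f₀∈X = ¬[f₀∉X⇒aligned] λ f₀∉X → ⊥-elim (f₀∉X f₀∈X)

    rk-⁺ : ∀ {F} → F ⊆ X → Liftable F → r (F ⁺) ≡ suc (r F)
    rk-⁺ F⊆X lift = ≤-antisym lift (rk-<-off-X F⊆X e₀∉X (p⊆p∪q _) e₀∈⁺)

    ⁺-flat : ∀ {F} → FlatIn M X F → Liftable F → FlatIn M ⊤ (F ⁺)
    ⁺-flat {F} (F⊆X , covers) lift = flatIn⁺ (λ _ → ∈⊤) grows
      where
      grows : ∀ x → x ∈ ⊤ → x ∉ F ⁺ → suc (r (F ⁺)) ≤ r (F ⁺ ∪ ⁅ x ⁆)
      grows x _ x∉F⁺ = begin
        suc (r (F ⁺))        ≡⟨ cong suc (rk-⁺ F⊆X lift) ⟩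
        suc (suc (r F))      ≡⟨ cong suc (sym (covers x x∈X (x∉F⁺ ∘ p⊆p∪q _))) ⟩
        suc (r (F ∪ ⁅ x ⁆))  ≤⟨ rk-<-off-X (∪-lub F⊆X (⁅x⁆⊆p x∈X)) e₀∉X
                                  (∪-mono (p⊆p∪q _) ⊆-refl) (p⊆p∪q _ e₀∈⁺) ⟩
        r (F ⁺ ∪ ⁅ x ⁆)      ∎
        where
        open ≤-Reasoning
        x∈X : x ∈ X
        x∈X = x∉∁p⇒x∈p (x∉F⁺ ∘ q⊆p∪q F (∁ X))

    ⁺-coatomIn : ∀ {F} → F ⊆ X → Liftable F → CoatomIn M (F ⁺) F
    ⁺-coatomIn {F} F⊆X lift = flatIn⁺ (p⊆p∪q _) grows , sym (rk-⁺ F⊆X lift)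
      where
      grows : ∀ e → e ∈ F ⁺ → e ∉ F → suc (r F) ≤ r (F ∪ ⁅ e ⁆)
      grows e e∈F⁺ e∉F =
        rk-<-off-X F⊆X (e∉F ∘ x∈p∪∁q∧x∈q⇒x∈p e∈F⁺) (p⊆p∪q _) x∈p∪⁅x⁆

    ⁺-modularIn : ∀ {F} → FlatIn M X F → Liftable F → ModularIn M (F ⁺) F
    ⁺-modularIn {F} fF lift = modularIn⁺ (proj₁ (⁺-coatomIn F⊆X lift)) λ W fW → ineq fW (⊆⊎⊈ W X)
      where
      F⊆X : F ⊆ X
      F⊆X = proj₁ fF
      ineq : ∀ {W} → FlatIn M (F ⁺) W → W ⊆ X ⊎ (∃ λ e → e ∈ W × e ∉ X) →
             r F + r W ≤ r (F ∩ W) + r (F ∪ W)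
      ineq {W} (W⊆F⁺ , _) (inj₁ W⊆X) = begin
        r F + r W        ≤⟨ +-mono-≤ (mono (p⊆p∪q W)) (mono (∩-glb W⊆F ⊆-refl)) ⟩
        r (F ∪ W) + r (F ∩ W)  ≡⟨ +-comm (r (F ∪ W)) _ ⟩
        r (F ∩ W) + r (F ∪ W)  ∎
        where
        open ≤-Reasoning
        W⊆F : W ⊆ F
        W⊆F w∈W = x∈p∪∁q∧x∈q⇒x∈p (W⊆F⁺ w∈W) (W⊆X w∈W)
      ineq {W} fW (inj₂ (e , e∈W , e∉X)) = begin
        r F + r W              ≤⟨ +-monoʳ-≤ (r F) (rk≤suc-rk-X∩ (flatIn-trans (⁺-flat fF lift) fW)) ⟩
        r F + suc (r (X ∩ W))  ≤⟨ +-monoʳ-≤ (r F) (s≤s (mono X∩W⊆F∩W)) ⟩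
        r F + suc (r (F ∩ W))  ≡⟨ +-suc-comm (r F) _ ⟩
        r (F ∩ W) + suc (r F)  ≤⟨ +-monoʳ-≤ _ (rk-<-off-X F⊆X e∉X (p⊆p∪q W) (q⊆p∪q F W e∈W)) ⟩
        r (F ∩ W) + r (F ∪ W)  ∎
        where
        open ≤-Reasoning
        X∩W⊆F∩W : X ∩ W ⊆ F ∩ W
        X∩W⊆F∩W x∈ = let (x∈X , x∈W) = x∈p∩q⁻ X W x∈ in
          x∈p∩q⁺ (x∈p∪∁q∧x∈q⇒x∈p (proj₁ fW x∈W) x∈X , x∈W)

    ⁺-modular : ∀ {F} → ModularIn M X F → Liftable F → ModularIn M ⊤ (F ⁺)
    ⁺-modular {F} mF lift = modularIn⁺ (⁺-flat (proj₁ mF) lift) λ W fW → ineq fW (⊆⊎⊈ W X)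
      where
      F⊆X : F ⊆ X
      F⊆X = proj₁ (proj₁ mF)
      ∪-grows : ∀ W → suc (r (F ∪ (X ∩ W))) ≤ r (F ⁺ ∪ W)
      ∪-grows W = rk-<-off-X (∪-lub F⊆X (p∩q⊆p X W)) e₀∉X
                    (∪-mono (p⊆p∪q _) (p∩q⊆q X W)) (p⊆p∪q W e₀∈⁺)
      ∩⊆ : ∀ W → F ∩ W ⊆ F ⁺ ∩ W
      ∩⊆ W = ∩-mono (p⊆p∪q _) ⊆-refl
      ineq : ∀ {W} → FlatIn M ⊤ W → W ⊆ X ⊎ (∃ λ e → e ∈ W × e ∉ X) →
             r (F ⁺) + r W ≤ r (F ⁺ ∩ W) + r (F ⁺ ∪ W)
      ineq {W} fW (inj₁ W⊆X) = begin
        r (F ⁺) + r W                      ≡⟨ cong (_+ r W) (rk-⁺ F⊆X lift) ⟩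
        suc (r F + r W)                    ≤⟨ s≤s (+-monoʳ-≤ (r F) (mono (∩-glb W⊆X ⊆-refl))) ⟩
        suc (r F + r (X ∩ W))              ≤⟨ s≤s (modularIn-X∩ mF fW) ⟩
        suc (r (F ∩ W) + r (F ∪ (X ∩ W)))  ≡⟨ sym (+-suc _ _) ⟩
        r (F ∩ W) + suc (r (F ∪ (X ∩ W)))  ≤⟨ +-mono-≤ (mono (∩⊆ W)) (∪-grows W) ⟩
        r (F ⁺ ∩ W) + r (F ⁺ ∪ W)          ∎
        where open ≤-Reasoning
      ineq {W} fW (inj₂ (w , w∈W , w∉X)) = begin
        r (F ⁺) + r W                            ≡⟨ cong (_+ r W) (rk-⁺ F⊆X lift) ⟩
        suc (r F + r W)                          ≤⟨ s≤s (+-monoʳ-≤ (r F) (rk≤suc-rk-X∩ fW)) ⟩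
        suc (r F + suc (r (X ∩ W)))              ≡⟨ cong suc (+-suc (r F) _) ⟩
        suc (suc (r F + r (X ∩ W)))              ≤⟨ s≤s (s≤s (modularIn-X∩ mF fW)) ⟩
        suc (suc (r (F ∩ W) + r (F ∪ (X ∩ W))))  ≡⟨ cong suc (sym (+-suc _ _)) ⟩
        suc (r (F ∩ W)) + suc (r (F ∪ (X ∩ W)))  ≤⟨ +-mono-≤ ∩-grows (∪-grows W) ⟩
        r (F ⁺ ∩ W) + r (F ⁺ ∪ W)                ∎
        where
        open ≤-Reasoning
        ∩-grows : suc (r (F ∩ W)) ≤ r (F ⁺ ∩ W)
        ∩-grows = rk-<-off-X (F⊆X ∘ p∩q⊆p F W) w∉X (∩⊆ W)
                    (x∈p∩q⁺ (q⊆p∪q F (∁ X) (x∉p⇒x∈∁p w∉X) , w∈W))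

    ⁺-⊂⊤ : ∀ {F} → F ⊂ X → F ⁺ ⊂ ⊤
    ⁺-⊂⊤ (_ , x , x∈X , x∉F) = (λ _ → ∈⊤) , x , ∈⊤ , λ x∈F⁺ → x∉F (x∈p∪∁q∧x∈q⇒x∈p x∈F⁺ x∈X)

    ⊂X⇒⊂⊤ : ∀ {F} → F ⊂ X → F ⊂ ⊤
    ⊂X⇒⊂⊤ (F⊆X , _) = (λ _ → ∈⊤) , e₀ , ∈⊤ , e₀∉X ∘ F⊆X

    ⁺-∪ : ∀ {F₁ F₂} → F₁ ∪ F₂ ≡ X → F₁ ⁺ ∪ F₂ ≡ ⊤
    ⁺-∪ {F₁} {F₂} F₁∪F₂≡X = begin
      (F₁ ∪ ∁ X) ∪ F₂  ≡⟨ ∪-assoc F₁ (∁ X) F₂ ⟩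
      F₁ ∪ (∁ X ∪ F₂)  ≡⟨ cong (F₁ ∪_) (∪-comm (∁ X) F₂) ⟩
      F₁ ∪ (F₂ ∪ ∁ X)  ≡⟨ sym (∪-assoc F₁ F₂ (∁ X)) ⟩
      (F₁ ∪ F₂) ∪ ∁ X  ≡⟨ cong (_∪ ∁ X) F₁∪F₂≡X ⟩
      X ∪ ∁ X          ≡⟨ p∪∁p≡⊤ X ⟩
      ⊤                ∎
      where open ≡-Reasoning

    ⁺-∩ : ∀ {Y F₁ F₂} → F₂ ⊆ X → F₁ ∩ F₂ ≡ Y → F₁ ⁺ ∩ F₂ ≡ Y
    ⁺-∩ {Y} {F₁} {F₂} F₂⊆X F₁∩F₂≡Y = begin
      (F₁ ∪ ∁ X) ∩ F₂         ≡⟨ ∩-distribʳ-∪ F₂ F₁ (∁ X) ⟩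
      (F₁ ∩ F₂) ∪ (∁ X ∩ F₂)  ≡⟨ cong₂ _∪_ F₁∩F₂≡Y (p⊆q⇒∁q∩p≡⊥ F₂⊆X) ⟩
      Y ∪ ⊥                   ≡⟨ ∪-identityʳ Y ⟩
      Y                       ∎
      where open ≡-Reasoning

    lift-modJoinIn : ∀ {Y F₁ F₂} → ModJoinIn M X Y F₁ F₂ → Liftable F₁ →
      ∃[ F₁′ ] (FlatIn M ⊤ F₁′ × ModularIn M F₁′ F₁ × CoatomIn M F₁′ F₁ × ModJoinIn M ⊤ Y F₁′ F₂)
    lift-modJoinIn {Y} {F₁} {F₂} (mF₁ , F₁⊂X , mF₂ , F₂⊂X , F₁∪F₂≡X , F₁∩F₂≡Y) lift =
      F₁ ⁺ , ⁺-flat (proj₁ mF₁) lift , ⁺-modularIn (proj₁ mF₁) lift , ⁺-coatomIn (proj₁ F₁⊂X) lift ,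
      ⁺-modular mF₁ lift , ⁺-⊂⊤ F₁⊂X , modularIn-trans mF₂ , ⊂X⇒⊂⊤ F₂⊂X ,
      ⁺-∪ F₁∪F₂≡X , ⁺-∩ (proj₁ F₂⊂X) F₁∩F₂≡Y

lemma3p3 : ∀ {n : ℕ} (M : Matroid n) → Simple M
    → (X Y F₁ F₂ : Subset n)
    → ModularIn M ⊤ X → CoatomIn M ⊤ X
    → ModJoinIn M X Y F₁ F₂
    → (∃[ F₁′ ] (FlatIn M ⊤ F₁′ × ModularIn M F₁′ F₁ × CoatomIn M F₁′ F₁
                  × ModJoinIn M ⊤ Y F₁′ F₂))
      ⊎ (∃[ F₂′ ] (FlatIn M ⊤ F₂′ × ModularIn M F₂′ F₂ × CoatomIn M F₂′ F₂
                  × ModJoinIn M ⊤ Y F₁ F₂′))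
lemma3p3 M S X Y F₁ F₂ modX coX join@(_ , F₁⊂X , _ , F₂⊂X , F₁∪F₂≡X , _) =
  Sum.map (lift-modJoinIn join)
          (λ lift → let (F₂′ , fF₂′ , mF₂ , cF₂ , join′) = lift-modJoinIn (modJoinIn-swap M join) lift
                    in F₂′ , fF₂′ , mF₂ , cF₂ , modJoinIn-swap M join′)
          (liftable-part S (proj₁ F₁⊂X) (proj₁ F₂⊂X) (⊆-reflexive (sym F₁∪F₂≡X)))
  where open ModularCoatom M modX coX
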